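{- Let $C[\cdot]$ be a CCS context that does not contain the parallel operator. Then for all CCS processes $P,Q$, if $C[P]\not\,\dot\sim^{\tau}\,C[Q]$ then $P\not\,\dot\sim^{\tau}\,Q$.
   Context: CCS with names $\mathsf{N}$, co-names $\overline{\mathsf{N}}$, labels $\mathsf{L}=\mathsf{N}\cup\overline{\mathsf{N}}\cup\{\tau\}$, processes $P,Q::=\lambda.P\mid P|Q\mid \lambda.P+\pi.Q\mid P\backslash a\mid 0$ and the standard CCS labelled transition system. Contexts are given by $C[\cdot]::=[\cdot]\mid \lambda.C[\cdot]\mid P\,|\,C[\cdot]\mid C[\cdot]\backslash a$. A reduction $P\to P'$ is a transition $P\xrightarrow{\tau}P'$; $P\downarrow_\alpha$ iff $P\xrightarrow{\alpha}P'$ for some $P'$. A barbed bisimulation is a symmetric relation $\mathcal{R}$ on CCS processes such that whenever $P\mathcal{R}Q$: $P\to P'$ implies $Q\to Q'$ with $P'\mathcal{R}Q'$, and $P\downarrow_a$ implies $Q\downarrow_a$. $P\,\dot\sim^{\tau}\,Q$ iff some barbed bisimulation relates them. -}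

module Defs where

open import Data.Nat using (ℕ)
open import Data.Product using (Σ; ∃; _×_)
open import Relation.Binary.PropositionalEquality using (_≡_; _≢_)
open import Relation.Nullary using (¬_)

Name : Set
Name = ℕ

data Label : Set where
  nm  : Name → Label
  co  : Name → Label
  τ   : Label

data Compl : Label → Label → Set where
  nm-co : ∀ a → Compl (nm a) (co a)
  co-nm : ∀ a → Compl (co a) (nm a)

data Proc : Set where
  _∙_   : Label → Proc → Proc
  _∣_   : Proc → Proc → Proc
  sum   : Label → Proc → Label → Proc → Proc   -- sum λ P π Q  =  λ.P + π.Q
  _∖_   : Proc → Name → Proc
  𝟎     : Proc

infixr 7 _∙_
infixl 5 _∣_
infixl 6 _∖_

data _─[_]→_ : Proc → Label → Proc → Set where
  pre   : ∀ {l P} → (l ∙ P) ─[ l ]→ P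
  sumL  : ∀ {l P π Q} → sum l P π Q ─[ l ]→ P
  sumR  : ∀ {l P π Q} → sum l P π Q ─[ π ]→ Q
  parL  : ∀ {P P' Q α} → P ─[ α ]→ P' → (P ∣ Q) ─[ α ]→ (P' ∣ Q)
  parR  : ∀ {P Q Q' α} → Q ─[ α ]→ Q' → (P ∣ Q) ─[ α ]→ (P ∣ Q')
  com   : ∀ {P P' Q Q' α β} → Compl α β → P ─[ α ]→ P' → Q ─[ β ]→ Q' →
          (P ∣ Q) ─[ τ ]→ (P' ∣ Q')
  res   : ∀ {P P' α a} → α ≢ nm a → α ≢ co a → P ─[ α ]→ P' →
          (P ∖ a) ─[ α ]→ (P' ∖ a)

_⟶_ : Proc → Proc → Set
P ⟶ P' = P ─[ τ ]→ P'

_↓_ : Proc → Label → Set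
P ↓ α = ∃ λ P' → P ─[ α ]→ P'

data Context : Set where
  hole  : Context
  pre   : Label → Context → Context
  par   : Proc → Context → Context
  res   : Context → Name → Context

_[_] : Context → Proc → Proc
hole      [ P ] = P
pre l C   [ P ] = l ∙ (C [ P ])
par R C   [ P ] = R ∣ (C [ P ])
res C a   [ P ] = (C [ P ]) ∖ a

data NoPar : Context → Set where
  hole : NoPar hole
  pre  : ∀ {l C} → NoPar C → NoPar (pre l C)
  res  : ∀ {C a} → NoPar C → NoPar (res C a)

record IsBarbedBisim (R : Proc → Proc → Set) : Set where
  field
    symm   : ∀ {P Q} → R P Q → R Q P
    red    : ∀ {P Q P'} → R P Q → P ⟶ P' → ∃ λ Q' → (Q ⟶ Q') × R P' Q'
    barb   : ∀ {P Q} (a : Name) → R P Q → P ↓ nm a → Q ↓ nm a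

_∼τ_ : Proc → Proc → Set₁
P ∼τ Q = Σ (Proc → Proc → Set) λ R → IsBarbedBisim R × R P Q

module Submission where

-- Barbed bisimilarity is preserved by every context built
-- without the parallel operator: given a barbed bisimulation R, close it
-- under prefixing and restriction.  The closure is again a barbed
-- bisimulation, because a prefixed process λ.P can only perform the single
-- action λ (so a τ-prefix reduces to P, resp. Q, and a name-prefix exhibits
-- the same barb on both sides), while a restriction P∖a moves exactly as P
-- does on actions other than a, ā, so the step of P is matched by the
-- corresponding step of Q, restricted in turn.  Hence P ∼τ Q implies
-- C[P] ∼τ C[Q] for par-free C, and the theorem is its contrapositive.

open import Defs
open import Relation.Nullary using (¬_)
open import Data.Product using (∃; _×_; _,_)

data Closure (R : Proc → Proc → Set) : Proc → Proc → Set where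
  base     : ∀ {P Q} → R P Q → Closure R P Q
  prefix   : ∀ {P Q} l → Closure R P Q → Closure R (l ∙ P) (l ∙ Q)
  restrict : ∀ {P Q} a → Closure R P Q → Closure R (P ∖ a) (Q ∖ a)

plug : ∀ {R P Q} (C : Context) → NoPar C → R P Q →
       Closure R (C [ P ]) (C [ Q ])
plug hole      hole     r = base r
plug (pre l C) (pre np) r = prefix l (plug C np r)
plug (res C a) (res np) r = restrict a (plug C np r)

module ClosureOfBisimulation {R : Proc → Proc → Set} (B : IsBarbedBisim R) where
  open IsBarbedBisim B

  closure-symm : ∀ {P Q} → Closure R P Q → Closure R Q P
  closure-symm (base r)       = base (symm r)
  closure-symm (prefix l c)   = prefix l (closure-symm c)
  closure-symm (restrict a c) = restrict a (closure-symm c)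

  closure-red : ∀ {P Q P'} → Closure R P Q → P ⟶ P' →
                ∃ λ Q' → (Q ⟶ Q') × Closure R P' Q'
  closure-red (base r) t with red r t
  ... | Q' , t' , r' = Q' , t' , base r'
  closure-red (prefix .τ c) pre = _ , pre , c
  closure-red (restrict a c) (res a≢ ā≢ t) with closure-red c t
  ... | Q' , t' , c' = Q' ∖ a , res a≢ ā≢ t' , restrict a c'

  closure-barb : ∀ {P Q} (a : Name) → Closure R P Q → P ↓ nm a → Q ↓ nm a
  closure-barb a (base r) b = barb a r b
  closure-barb a (prefix .(nm a) c) (_ , pre) = _ , pre
  closure-barb a (restrict b c) (_ , res a≢ ā≢ t) with closure-barb a c (_ , t)
  ... | Q' , t' = Q' ∖ b , res a≢ ā≢ t'

  closure-bisim : IsBarbedBisim (Closure R)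
  closure-bisim = record
    { symm = closure-symm ; red = closure-red ; barb = closure-barb }

open ClosureOfBisimulation using (closure-bisim)

∼τ-parFree-congruence : (C : Context) → NoPar C → ∀ {P Q} →
                        P ∼τ Q → (C [ P ]) ∼τ (C [ Q ])
∼τ-parFree-congruence C np (R , B , r) = Closure R , closure-bisim B , plug C np r

mainTheorem5 : (C : Context) → NoPar C → (P Q : Proc) →
    ¬ ((C [ P ]) ∼τ (C [ Q ])) → ¬ (P ∼τ Q)
mainTheorem5 C np P Q C[P]≁C[Q] P∼Q = C[P]≁C[Q] (∼τ-parFree-congruence C np P∼Q)
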